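{- Let $\pi=\alpha+\beta i$ be a Gaussian prime whose norm $p=N(\pi)=\alpha^2+\beta^2$ is a rational prime with $p\equiv 1 \pmod 4$. Let $a+bi$ be a Gaussian prime whose norm $q=a^2+b^2$ is a rational prime with $q\equiv 1\pmod 4$ and $q\neq p$. Then $$\left[\frac{a+bi}{\alpha+\beta i}\right]\cdot\left[\frac{b+ai}{\alpha+\beta i}\right]=(-1)^{\frac{p-1}{4}}\left(\frac{q}{p}\right).$$ In particular, $\left[\frac{a+bi}{\alpha+\beta i}\right]=\left[\frac{b+ai}{\alpha+\beta i}\right]$ if and only if $(-1)^{(p-1)/4}\left(\frac{q}{p}\right)=1$.
   Context: For a Gaussian prime $\pi$ not associated to $1+i$ and a Gaussian integer $k$ not divisible by $\pi$, the Gaussian Legendre symbol $\left[\frac{k}{\pi}\right]$ equals $1$ if the congruence $x^2\equiv k \pmod{\pi}$ has a solution $x\in\mathbb{Z}[i]$ and $-1$ otherwise; equivalently (Euler's criterion) $\left[\frac{k}{\pi}\right]\equiv k^{(N(\pi)-1)/2}\pmod{\pi}$. It is multiplicative in $k$ and depends only on $k$ modulo $\pi$. Here $N(x+yi)=x^2+y^2$, and $\left(\frac{q}{p}\right)$ denotes the usual Legendre symbol modulo the odd rational prime $p$. -}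

module Defs where

open import Data.Integer using (ℤ; +_; -_; _+_; _-_; _*_; ∣_∣)
open import Data.Nat using (ℕ)
open import Data.Product using (_×_; _,_; ∃)
open import Data.Sum using (_⊎_)
open import Relation.Nullary using (¬_)
open import Relation.Binary.PropositionalEquality using (_≡_)
open import Data.Integer.Divisibility using () renaming (_∣_ to _∣ℤ_)

-- Gaussian integers x + y i represented as pairs (x , y) of integers.
GI : Set
GI = ℤ × ℤ

infixl 6 _-G_
infixl 7 _*G_

_-G_ : GI → GI → GI
(a , b) -G (c , d) = (a - c , b - d)

_*G_ : GI → GI → GI
(a , b) *G (c , d) = (a * c - b * d , a * d + b * c)

normG : GI → ℕ
normG (x , y) = ∣ x * x + y * y ∣

_∣G_ : GI → GI → Set
π ∣G z = ∃ λ c → π *G c ≡ z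

GaussQR : GI → GI → Set
GaussQR k π = ∃ λ x → π ∣G (x *G x -G k)

GaussLegendre : GI → GI → ℤ → Set
GaussLegendre k π s = ¬ (π ∣G k) × ((s ≡ + 1 × GaussQR k π) ⊎ (s ≡ - + 1 × ¬ GaussQR k π))

RatQR : ℤ → ℤ → Set
RatQR q p = ∃ λ x → p ∣ℤ (x * x - q)

Legendre : ℤ → ℤ → ℤ → Set
Legendre q p s = ¬ (p ∣ℤ q) × ((s ≡ + 1 × RatQR q p) ⊎ (s ≡ - + 1 × ¬ RatQR q p))

-- Reduce everything modulo p.  Since α² + β² = p, the element j = -α/β of
-- ℤ/p satisfies α + βj ≡ 0 and j² ≡ -1, so x + yi ↦ x + yj is a ring
-- homomorphism ℤ[i] → ℤ/p whose kernel is exactly the ideal (π).  It turns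
-- [k/π] into the ordinary Legendre symbol of the image of k, which by Euler's
-- criterion is congruent to its (p-1)/2-th power.  As
-- (a + bj)(b + aj) = ab(1 + j²) + (a² + b²)j ≡ qj, the product of the two
-- symbols is congruent to q^((p-1)/2) j^((p-1)/2) ≡ (q/p)(-1)^((p-1)/4), and two
-- signs that are congruent modulo an odd prime are equal.
--
-- Euler's criterion is proved by Wilson's pairing argument: the nonzero
-- residues split into pairs {x, y} with xy ≡ c, plus the two square roots ±s
-- of c when c = s² is a square.

module Submission where

open import Defs
open import Data.Integer
  using (ℤ; +_; -[1+_]; -_; _+_; _-_; _*_; _^_; ∣_∣; 0ℤ; 1ℤ)
import Data.Integer.Properties as ℤ
open import Data.Integer.DivMod using (_%ℕ_; _/ℕ_; a≡a%ℕn+[a/ℕn]*n; n%ℕd<d)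
open import Data.Integer.Divisibility.Signed
  using (_∣_; divides; ∣ᵤ⇒∣; ∣⇒∣ᵤ; ∣-refl; ∣-trans; ∣m∣n⇒∣m+n; ∣m∣n⇒∣m-n; ∣m⇒∣-m; ∣m⇒∣m*n; ∣n⇒∣m*n;
         *-monoʳ-∣; *-monoˡ-∣; *-cancelˡ-∣)
open import Data.Integer.Tactic.RingSolver using (solve; solve-∀)
open import Data.List using ([]; _∷_)
open import Data.List.Fresh using (List#; []; cons; _∷#_; _#_; length)
open import Data.List.Fresh.Relation.Unary.Any using (Any; here; there; _─_)
open import Data.List.Fresh.Relation.Unary.Any.Properties using (length-remove)
open import Data.Nat as ℕ using (ℕ; zero; suc; _/_; _%_; _∸_; _<_; _≤_; z≤n; s≤s)
import Data.Nat.Properties as ℕ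
import Data.Nat.DivMod as ℕ
import Data.Nat.Divisibility as ℕ
import Data.Nat.Tactic.RingSolver as ℕ-Solver
open import Data.Nat.Coprimality using (Coprime; coprime-Bézout)
open import Data.Nat.GCD using (module Bézout)
open import Data.Nat.Primality
  using (Prime; prime⇒nonZero; prime⇒irreducible; euclidsLemma; ¬prime[1])
open import Data.Product using (∃; _×_; _,_; proj₁; proj₂)
import Data.Product as Product
open import Data.Sum using (_⊎_; inj₁; inj₂)
import Data.Sum as Sum
open import Function using (id; _∘_)
open import Function.Bundles using (_⇔_; mk⇔)
open import Level using (0ℓ)
open import Relation.Binary.Bundles using (Setoid)
open import Relation.Binary.PropositionalEquality
  using (_≡_; refl; sym; trans; cong; cong₂; subst; module ≡-Reasoning)
open import Relation.Nullary using (¬_; contradiction)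
import Relation.Binary.Reasoning.Setoid as SetoidReasoning
import Data.List.Fresh.Membership.Setoid as FreshMembership
import Data.List.Fresh.Membership.Setoid.Properties as FreshMembershipProperties

private variable
  x y z u v c ε : ℤ

IsSign : ℤ → Set
IsSign x = x ≡ 1ℤ ⊎ x ≡ - 1ℤ

IsSign-* : IsSign x → IsSign y → IsSign (x * y)
IsSign-* (inj₁ refl) (inj₁ refl) = inj₁ refl
IsSign-* (inj₁ refl) (inj₂ refl) = inj₂ refl
IsSign-* (inj₂ refl) (inj₁ refl) = inj₂ refl
IsSign-* (inj₂ refl) (inj₂ refl) = inj₁ refl

IsSign-^ : ∀ n → IsSign x → IsSign (x ^ n)
IsSign-^ zero    _ = inj₁ refl
IsSign-^ (suc n) s = IsSign-* s (IsSign-^ n s)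

IsSign-square : IsSign x → x * x ≡ 1ℤ
IsSign-square (inj₁ refl) = refl
IsSign-square (inj₂ refl) = refl

IsSign-*≡1⇒≡ : IsSign x → IsSign y → x * y ≡ 1ℤ → x ≡ y
IsSign-*≡1⇒≡ (inj₁ refl) (inj₁ refl) _ = refl
IsSign-*≡1⇒≡ (inj₂ refl) (inj₂ refl) _ = refl
IsSign-*≡1⇒≡ (inj₁ refl) (inj₂ refl) ()
IsSign-*≡1⇒≡ (inj₂ refl) (inj₁ refl) ()

symbol-IsSign : ∀ {A B : Set} → (ε ≡ 1ℤ × A) ⊎ (ε ≡ - 1ℤ × B) → IsSign ε
symbol-IsSign = Sum.map proj₁ proj₁

∣-≡ : ∀ {m} → m ∣ u → u ≡ v → m ∣ v
∣-≡ m∣u refl = m∣u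

^-distribʳ-* : ∀ n → (x * y) ^ n ≡ x ^ n * y ^ n
^-distribʳ-* zero    = refl
^-distribʳ-* {x} {y} (suc n) = trans (cong (x * y *_) (^-distribʳ-* n)) (shuffle x y (x ^ n) (y ^ n))
  where
  shuffle : ∀ x y u v → x * y * (u * v) ≡ x * u * (y * v)
  shuffle = solve-∀

square≡+∣∣² : ∀ x → x * x ≡ + (∣ x ∣ ℕ.* ∣ x ∣)
square≡+∣∣² (+ n)    = sym (ℤ.pos-* n n)
square≡+∣∣² -[1+ n ] = refl

sum-of-squares≡+ : ∀ x y → x * x + y * y ≡ + (∣ x ∣ ℕ.* ∣ x ∣ ℕ.+ ∣ y ∣ ℕ.* ∣ y ∣)
sum-of-squares≡+ x y = trans (cong₂ _+_ (square≡+∣∣² x) (square≡+∣∣² y)) (sym (ℤ.pos-+ (∣ x ∣ ℕ.* ∣ x ∣) (∣ y ∣ ℕ.* ∣ y ∣)))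

normG≡⇒sum-of-squares≡ : ∀ x y {n} → normG (x , y) ≡ n → x * x + y * y ≡ + n
normG≡⇒sum-of-squares≡ x y refl = trans (sum-of-squares≡+ x y) (cong (+_ ∘ ∣_∣) (sym (sum-of-squares≡+ x y)))

m+m≡2+n⇒m≡1+k : ∀ {m n} → m ℕ.+ m ≡ suc (suc n) → ∃ λ k → m ≡ suc k × n ≡ k ℕ.+ k
m+m≡2+n⇒m≡1+k {zero}  ()
m+m≡2+n⇒m≡1+k {suc k} eq = k , refl , sym (ℕ.suc-injective (trans (sym (ℕ.+-suc k k)) (ℕ.suc-injective eq)))

p%4≡1⇒p≡1+4[p-1]/4 : ∀ {p} → p % 4 ≡ 1 → p ≡ suc ((p ∸ 1) / 4 ℕ.+ (p ∸ 1) / 4 ℕ.+ ((p ∸ 1) / 4 ℕ.+ (p ∸ 1) / 4))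
p%4≡1⇒p≡1+4[p-1]/4 {p} p%4≡1 = trans p≡1+e*4 (cong suc (trans (cong (ℕ._* 4) (sym e≡)) (four-times ((p ∸ 1) / 4))))
  where
  e : ℕ
  e = p / 4
  p≡1+e*4 : p ≡ suc (e ℕ.* 4)
  p≡1+e*4 = trans (ℕ.m≡m%n+[m/n]*n p 4) (cong (ℕ._+ e ℕ.* 4) p%4≡1)
  e≡ : (p ∸ 1) / 4 ≡ e
  e≡ = trans (cong (λ n → (n ∸ 1) / 4) p≡1+e*4) (ℕ.m*n/n≡m e 4)
  four-times : ∀ e → e ℕ.* 4 ≡ e ℕ.+ e ℕ.+ (e ℕ.+ e)
  four-times = ℕ-Solver.solve-∀

module Congruence (m : ℤ) where

  infix 4 _≈_ _≉_

  record _≈_ (x y : ℤ) : Set where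
    constructor mk≈
    field m∣x-y : m ∣ x - y

  open _≈_ public

  _≉_ : ℤ → ℤ → Set
  x ≉ y = ¬ (x ≈ y)

  ≈-via : m ∣ u → u ≡ x - y → x ≈ y
  ≈-via m∣u refl = mk≈ m∣u

  ≡⇒≈ : x ≡ y → x ≈ y
  ≡⇒≈ {x} refl = ≈-via (divides 0ℤ (sym (ℤ.*-zeroˡ m))) (sym (ℤ.+-inverseʳ x))

  ≈-refl : x ≈ x
  ≈-refl = ≡⇒≈ refl

  ≈-sym : x ≈ y → y ≈ x
  ≈-sym {x} {y} (mk≈ d) = ≈-via (∣m⇒∣-m d) (solve (x ∷ y ∷ []))

  ≈-trans : x ≈ y → y ≈ z → x ≈ z
  ≈-trans {x} {y} {z} (mk≈ d) (mk≈ e) = ≈-via (∣m∣n⇒∣m+n d e) (solve (x ∷ y ∷ z ∷ []))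

  +-cong : x ≈ y → u ≈ v → x + u ≈ y + v
  +-cong {x} {y} {u} {v} (mk≈ d) (mk≈ e) = ≈-via (∣m∣n⇒∣m+n d e) (solve (x ∷ y ∷ u ∷ v ∷ []))

  -‿cong : x ≈ y → - x ≈ - y
  -‿cong {x} {y} (mk≈ d) = ≈-via (∣m⇒∣-m d) (solve (x ∷ y ∷ []))

  *-cong : x ≈ y → u ≈ v → x * u ≈ y * v
  *-cong {x} {y} {u} {v} (mk≈ d) (mk≈ e) =
    ≈-via (∣m∣n⇒∣m+n (∣m⇒∣m*n u d) (∣n⇒∣m*n y e)) (solve (x ∷ y ∷ u ∷ v ∷ []))

  *-congˡ : ∀ x → u ≈ v → x * u ≈ x * v
  *-congˡ x = *-cong (≈-refl {x})

  +-congˡ : ∀ x → u ≈ v → x + u ≈ x + v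
  +-congˡ x = +-cong (≈-refl {x})

  *-congʳ : ∀ u → x ≈ y → x * u ≈ y * u
  *-congʳ u x≈y = *-cong x≈y (≈-refl {u})

  -‿square : ∀ x → x * x ≈ y → - x * - x ≈ y
  -‿square x x²≈y = ≈-trans (≡⇒≈ (neg-square x)) x²≈y
    where
    neg-square : ∀ x → - x * - x ≡ x * x
    neg-square = solve-∀

  ^-cong : ∀ n → x ≈ y → x ^ n ≈ y ^ n
  ^-cong zero    _   = ≈-refl
  ^-cong (suc n) x≈y = *-cong x≈y (^-cong n x≈y)

  ∣⇒≈0 : m ∣ x → x ≈ 0ℤ
  ∣⇒≈0 {x} m∣x = ≈-via m∣x (sym (ℤ.+-identityʳ x))

  ≈0⇒∣ : x ≈ 0ℤ → m ∣ x
  ≈0⇒∣ {x} (mk≈ d) = subst (m ∣_) (ℤ.+-identityʳ x) d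

  m≈0 : m ≈ 0ℤ
  m≈0 = ∣⇒≈0 (divides 1ℤ (sym (ℤ.*-identityˡ m)))

  ∣-resp-≈ : x ≈ y → m ∣ x → m ∣ y
  ∣-resp-≈ x≈y m∣x = ≈0⇒∣ (≈-trans (≈-sym x≈y) (∣⇒≈0 m∣x))

  ≈-setoid : Setoid 0ℓ 0ℓ
  ≈-setoid = record
    { Carrier       = ℤ
    ; _≈_           = _≈_
    ; isEquivalence = record { refl = ≈-refl ; sym = ≈-sym ; trans = ≈-trans }
    }

  module ≈-Reasoning = SetoidReasoning ≈-setoid

module PrimeModulus (p : ℕ) (p-prime : Prime p) where

  open Congruence (+ p) public
  open ≈-Reasoning

  instance
    p-nonZero : ℕ.NonZero p
    p-nonZero = prime⇒nonZero p-prime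

  euclid : + p ∣ x * y → (+ p ∣ x) ⊎ (+ p ∣ y)
  euclid {x} {y} p∣xy = Sum.map ∣ᵤ⇒∣ ∣ᵤ⇒∣
    (euclidsLemma ∣ x ∣ ∣ y ∣ p-prime (subst (p ℕ.∣_) (ℤ.abs-* x y) (∣⇒∣ᵤ p∣xy)))

  p∤1 : ¬ (+ p ∣ 1ℤ)
  p∤1 p∣1 = ¬prime[1] (subst Prime (ℕ.∣1⇒≡1 (∣⇒∣ᵤ p∣1)) p-prime)

  *-nonzero : ¬ (+ p ∣ x) → ¬ (+ p ∣ y) → ¬ (+ p ∣ x * y)
  *-nonzero p∤x p∤y = Sum.[ p∤x , p∤y ] ∘ euclid

  *-cancelˡ : ¬ (+ p ∣ x) → x * y ≈ x * z → y ≈ z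
  *-cancelˡ {x} {y} {z} p∤x (mk≈ d) =
    Sum.[ (λ p∣x → contradiction p∣x p∤x) , mk≈ {y} {z} ]
      (euclid {x} {y - z} (∣-≡ d (solve (x ∷ y ∷ z ∷ []))))

  *-cancelʳ : ¬ (+ p ∣ y) → x * y ≈ z * y → x ≈ z
  *-cancelʳ {y} {x} {z} p∤y xy≈zy =
    *-cancelˡ p∤y (≈-trans (≡⇒≈ (ℤ.*-comm y x)) (≈-trans xy≈zy (≡⇒≈ (ℤ.*-comm z y))))

  square-roots : x * x ≈ y * y → (x ≈ y) ⊎ (x ≈ - y)
  square-roots {x} {y} (mk≈ d) = Sum.map mk≈ (λ p∣x+y → mk≈ (∣-≡ p∣x+y x+y≡x--y))
    (euclid (∣-≡ d x²-y²≡[x-y][x+y]))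
    where
    x²-y²≡[x-y][x+y] : x * x - y * y ≡ (x - y) * (x + y)
    x²-y²≡[x-y][x+y] = solve (x ∷ y ∷ [])
    x+y≡x--y : x + y ≡ x - - y
    x+y≡x--y = solve (x ∷ y ∷ [])

  ≈-residue : ∀ x → x ≈ + (x %ℕ p)
  ≈-residue x = ≈-via (divides (x /ℕ p) refl)
    (sym (trans (cong (_- r) (a≡a%ℕn+[a/ℕn]*n x p)) (add-sub r ((x /ℕ p) * + p))))
    where
    r : ℤ
    r = + (x %ℕ p)
    add-sub : ∀ r t → r + t - r ≡ t
    add-sub = solve-∀

  private
    ℕ-multiple≈0 : ∀ {k l} → k ≡ l ℕ.* p → + k ≈ 0ℤ
    ℕ-multiple≈0 {l = l} refl = ∣⇒≈0 (divides (+ l) (ℤ.pos-* l p))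

    pos-1+* : ∀ a b → + (1 ℕ.+ a ℕ.* b) ≡ 1ℤ + + a * + b
    pos-1+* a b = trans (ℤ.pos-+ 1 (a ℕ.* b)) (cong (λ t → 1ℤ + t) (ℤ.pos-* a b))

    rearrange : ∀ r b → r * - b ≡ 1ℤ - (1ℤ + b * r)
    rearrange = solve-∀

  inverse : ¬ (+ p ∣ x) → ∃ λ y → x * y ≈ 1ℤ
  inverse {x} p∤x with coprime-Bézout p⊥r
    where
    p⊥r : Coprime p (x %ℕ p)
    p⊥r (d∣p , d∣r) with prime⇒irreducible p-prime d∣p
    ... | inj₁ d≡1   = d≡1
    ... | inj₂ refl = contradiction (∣-resp-≈ (≈-sym (≈-residue x)) (∣ᵤ⇒∣ d∣r)) p∤x
  ... | Bézout.+- a b 1+br≡ap = - + b , (begin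
    x * - + b                        ≈⟨ *-congʳ (- + b) (≈-residue x) ⟩
    + r * - + b                      ≡⟨ rearrange (+ r) (+ b) ⟩
    1ℤ - (1ℤ + + b * + r)            ≡⟨ cong (λ t → 1ℤ - t) (sym (pos-1+* b r)) ⟩
    1ℤ - + (1 ℕ.+ b ℕ.* r)           ≈⟨ +-congˡ 1ℤ (-‿cong (ℕ-multiple≈0 {l = a} 1+br≡ap)) ⟩
    1ℤ - 0ℤ                          ∎)
    where
    r : ℕ
    r = x %ℕ p
  ... | Bézout.-+ a b 1+ap≡br = + b , (begin
    x * + b                          ≈⟨ *-congʳ (+ b) (≈-residue x) ⟩
    + r * + b                        ≡⟨ ℤ.*-comm (+ r) (+ b) ⟩
    + b * + r                        ≡⟨ sym (ℤ.pos-* b r) ⟩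
    + (b ℕ.* r)                      ≡⟨ cong +_ (sym 1+ap≡br) ⟩
    + (1 ℕ.+ a ℕ.* p)                ≡⟨ pos-1+* a p ⟩
    1ℤ + + a * + p                   ≈⟨ +-congˡ 1ℤ (∣⇒≈0 (divides (+ a) refl)) ⟩
    1ℤ + 0ℤ                          ∎)
    where
    r : ℕ
    r = x %ℕ p

  IsSquare : ℤ → Set
  IsSquare c = ∃ λ t → t * t ≈ c

-- Euler's criterion

module EulerCriterion (p : ℕ) (p-prime : Prime p) (d : ℕ) (p≡1+2d : p ≡ suc (d ℕ.+ d)) where

  open PrimeModulus p p-prime public
  open ≈-Reasoning

  small-nonzero : ∀ t → 0 < t → t < p → ¬ (+ p ∣ + t)
  small-nonzero t@(suc _) _ t<p p∣t = ℕ.<⇒≱ t<p (ℕ.∣⇒≤ (∣⇒∣ᵤ p∣t))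

  small-distinct : ∀ {i n} → i < n → n < p → + n ≉ + i
  small-distinct {i} {n} i<n n<p (mk≈ p∣n-i) =
    small-nonzero (n ∸ i) (ℕ.m<n⇒0<n∸m i<n) (ℕ.≤-<-trans (ℕ.m∸n≤m n i) n<p)
      (subst (+ p ∣_) (trans (ℤ.m-n≡m⊖n n i) (ℤ.⊖-≥ (ℕ.<⇒≤ i<n))) p∣n-i)

  p∤2 : ¬ (+ p ∣ + 2)
  p∤2 p∣2 = ¬prime[1] (subst Prime p≡1 p-prime)
    where
    1+2n≤2⇒n≡0 : ∀ n → suc (n ℕ.+ n) ≤ 2 → n ≡ 0
    1+2n≤2⇒n≡0 zero    _                 = refl
    1+2n≤2⇒n≡0 (suc n) (s≤s (s≤s 1+n+n≤0)) with () ← subst (_≤ 0) (ℕ.+-suc n n) 1+n+n≤0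
    p≡1 : p ≡ 1
    p≡1 = trans p≡1+2d (cong (λ n → suc (n ℕ.+ n)) (1+2n≤2⇒n≡0 d (subst (_≤ 2) p≡1+2d (ℕ.∣⇒≤ (∣⇒∣ᵤ p∣2)))))

  ≈-neg⇒∣ : x ≈ - x → + p ∣ x
  ≈-neg⇒∣ {x} (mk≈ d) = Sum.[ (λ p∣2 → contradiction p∣2 p∤2) , id ]
    (euclid {+ 2} {x} (∣-≡ d (solve (x ∷ []))))

  1≉-1 : 1ℤ ≉ - 1ℤ
  1≉-1 = p∤1 ∘ ≈-neg⇒∣

  IsSign-≈⇒≡ : IsSign x → IsSign y → x ≈ y → x ≡ y
  IsSign-≈⇒≡ (inj₁ refl) (inj₁ refl) _     = refl
  IsSign-≈⇒≡ (inj₁ refl) (inj₂ refl) 1≈-1 = contradiction 1≈-1 1≉-1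
  IsSign-≈⇒≡ (inj₂ refl) (inj₁ refl) -1≈1 = contradiction (≈-sym -1≈1) 1≉-1
  IsSign-≈⇒≡ (inj₂ refl) (inj₂ refl) _     = refl

  Residues : Set
  Residues = List# ℤ _≉_

  open FreshMembership ≈-setoid using (_∈_)
  open FreshMembershipProperties ≈-setoid using (≈-subst-∈; remove-inv; ∈-remove; fresh⇒∉; ∉-remove)

  ∈-─⁻ : ∀ {P : ℤ → Set} {xs : Residues} (k : Any P xs) → y ∈ (xs ─ k) → y ∈ xs
  ∈-─⁻ (here _)  y∈xs─k         = there y∈xs─k
  ∈-─⁻ (there k) (here y≈x)     = here y≈x
  ∈-─⁻ (there k) (there y∈xs─k) = there (∈-─⁻ k y∈xs─k)

  product : Residues → ℤ
  product []        = 1ℤ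
  product (x ∷# xs) = x * product xs

  product-─ : ∀ {xs} (k : x ∈ xs) → product xs ≈ x * product (xs ─ k)
  product-─ (here {xs = xs} x≈y) = *-congʳ (product xs) (≈-sym x≈y)
  product-─ {x} (there {x = y} {xs = xs} k) = begin
    y * product xs              ≈⟨ *-congˡ y (product-─ k) ⟩
    y * (x * product (xs ─ k))  ≡⟨ swap y x (product (xs ─ k)) ⟩
    x * (y * product (xs ─ k))  ∎
    where
    swap : ∀ y x r → y * (x * r) ≡ x * (y * r)
    swap = solve-∀

  Paired : ℤ → Residues → Set
  Paired c xs = ∀ {x} → x ∈ xs → ∃ λ y → y ∈ xs × x * y ≈ c

  RootFree : ℤ → Residues → Set
  RootFree c xs = ∀ {x} → x ∈ xs → x * x ≉ c

  module _ {c} (p∤c : ¬ (+ p ∣ c)) where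

    factor-nonzero : ∀ x → x * y ≈ c → ¬ (+ p ∣ y)
    factor-nonzero x xy≈c p∣y = p∤c (∣-resp-≈ xy≈c (∣n⇒∣m*n x p∣y))

    partner-unique : x * y ≈ c → z * y ≈ c → x ≈ z
    partner-unique {x} xy≈c zy≈c = *-cancelʳ (factor-nonzero x xy≈c) (≈-trans xy≈c (≈-sym zy≈c))

    Paired-remove-pair : ∀ {xs fr} → Paired c (cons x xs fr) →
                         (y∈xs : y ∈ xs) → x * y ≈ c → Paired c (xs ─ y∈xs)
    Paired-remove-pair {x} {y} {fr = x#xs} paired y∈xs xy≈c {z} z∈rest
      with paired (there (∈-─⁻ y∈xs z∈rest))
    ... | w , here w≈x , zw≈c =
      contradiction (≈-subst-∈ z≈y z∈rest) (∉-remove id id y∈xs)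
      where
      z≈y : z ≈ y
      z≈y = partner-unique (≈-trans (*-congˡ z (≈-sym w≈x)) zw≈c) (≈-trans (≡⇒≈ (ℤ.*-comm y x)) xy≈c)
    ... | w , there w∈xs , zw≈c with remove-inv y∈xs w∈xs
    ...   | inj₁ y≈w    = contradiction (≈-subst-∈ z≈x (∈-─⁻ y∈xs z∈rest)) (fresh⇒∉ id x#xs)
      where
      z≈x : z ≈ x
      z≈x = partner-unique (≈-trans (*-congˡ z y≈w) zw≈c) xy≈c
    ...   | inj₂ w∈rest = w , w∈rest , zw≈c

    Paired-remove-root : ∀ {xs} → Paired c xs → (x∈xs : x ∈ xs) → x * x ≈ c → Paired c (xs ─ x∈xs)
    Paired-remove-root {x} paired x∈xs x²≈c {z} z∈rest with paired (∈-─⁻ x∈xs z∈rest)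
    ... | w , w∈xs , zw≈c with remove-inv x∈xs w∈xs
    ...   | inj₁ x≈w    = contradiction (≈-subst-∈ z≈x z∈rest) (∉-remove id id x∈xs)
      where
      z≈x : z ≈ x
      z≈x = partner-unique (≈-trans (*-congˡ z x≈w) zw≈c) x²≈c
    ...   | inj₂ w∈rest = w , w∈rest , zw≈c

    product-pairs : ∀ m xs → length xs ≡ m ℕ.+ m → Paired c xs → RootFree c xs → product xs ≈ c ^ m
    product-pairs zero    []               _   _      _       = ≈-refl
    product-pairs (suc m) (cons x xs x#xs) len paired no-root with paired (here ≈-refl)
    ... | y , here y≈x , xy≈c = contradiction (≈-trans (*-congˡ x (≈-sym y≈x)) xy≈c) (no-root (here ≈-refl))
    ... | y , there y∈xs , xy≈c = begin
      x * product xs                  ≈⟨ *-congˡ x (product-─ y∈xs) ⟩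
      x * (y * product rest)          ≈⟨ *-congˡ x (*-congˡ y (product-pairs m rest len′ paired′ no-root′)) ⟩
      x * (y * c ^ m)                 ≡⟨ ℤ.*-assoc x y (c ^ m) ⟨
      x * y * c ^ m                   ≈⟨ *-congʳ (c ^ m) xy≈c ⟩
      c * c ^ m                       ∎
      where
      rest : Residues
      rest = xs ─ y∈xs
      len′ : length rest ≡ m ℕ.+ m
      len′ = ℕ.suc-injective (ℕ.suc-injective
        (trans (cong suc (sym (length-remove y∈xs))) (trans len (cong suc (ℕ.+-suc m m)))))
      paired′ : Paired c rest
      paired′ = Paired-remove-pair paired y∈xs xy≈c
      no-root′ : RootFree c rest
      no-root′ z∈rest = no-root (there (∈-─⁻ y∈xs z∈rest))

    product-pairs-with-roots : ∀ {s} n xs → length xs ≡ n ℕ.+ n → Paired c xs →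
                               s * s ≈ c → s ∈ xs → - s ∈ xs → product xs ≈ - (c ^ n)
    product-pairs-with-roots {s} n xs len paired s²≈c s∈xs -s∈xs = begin
      product xs                        ≈⟨ product-─ s∈xs ⟩
      s * product withoutS              ≈⟨ *-congˡ s (product-─ -s∈withoutS) ⟩
      s * (- s * product rest)          ≈⟨ *-congˡ s (*-congˡ (- s) (product-pairs k rest len′ paired′ no-root)) ⟩
      s * (- s * c ^ k)                 ≡⟨ rearrange s (c ^ k) ⟩
      - (s * s * c ^ k)                 ≈⟨ -‿cong (*-congʳ (c ^ k) s²≈c) ⟩
      - (c ^ suc k)                     ≡⟨ cong (λ n → - (c ^ n)) n≡1+k ⟨
      - (c ^ n)                         ∎
      where
      rearrange : ∀ s t → s * (- s * t) ≡ - (s * s * t)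
      rearrange = solve-∀
      withoutS : Residues
      withoutS = xs ─ s∈xs
      -s∈withoutS : - s ∈ withoutS
      -s∈withoutS = ∈-remove s∈xs -s∈xs (factor-nonzero s s²≈c ∘ ≈-neg⇒∣)
      rest : Residues
      rest = withoutS ─ -s∈withoutS
      half : ∃ λ k → n ≡ suc k × length rest ≡ k ℕ.+ k
      half = m+m≡2+n⇒m≡1+k (trans (sym len)
                             (trans (length-remove s∈xs) (cong suc (length-remove -s∈withoutS))))
      k : ℕ
      k = proj₁ half
      n≡1+k : n ≡ suc k
      n≡1+k = proj₁ (proj₂ half)
      len′ : length rest ≡ k ℕ.+ k
      len′ = proj₂ (proj₂ half)
      paired′ : Paired c rest
      paired′ = Paired-remove-root (Paired-remove-root paired s∈xs s²≈c) -s∈withoutS (-‿square s s²≈c)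
      no-root : RootFree c rest
      no-root z∈ z²≈c = Sum.[ (λ z≈s → ∉-remove id id s∈xs (≈-subst-∈ z≈s (∈-─⁻ -s∈withoutS z∈)))
                            , (λ z≈-s → ∉-remove id id -s∈withoutS (≈-subst-∈ z≈-s z∈)) ]
                            (square-roots (≈-trans z²≈c (≈-sym s²≈c)))

  smallResidues   : ∀ k → k < p → Residues
  smallResidues-# : ∀ k (k<p : k < p) {n} → k < n → n < p → + n # smallResidues k k<p

  smallResidues zero    _   = []
  smallResidues (suc k) k<p =
    cons (+ suc k) (smallResidues k (ℕ.<-trans (ℕ.n<1+n k) k<p)) (smallResidues-# k _ (ℕ.n<1+n k) k<p)

  smallResidues-# zero    _   _   _   = _
  smallResidues-# (suc k) k<p k<n n<p =
    small-distinct k<n n<p , smallResidues-# k _ (ℕ.<-trans (ℕ.n<1+n k) k<n) n<p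

  length-smallResidues : ∀ k (k<p : k < p) → length (smallResidues k k<p) ≡ k
  length-smallResidues zero    _   = refl
  length-smallResidues (suc k) k<p = cong suc (length-smallResidues k _)

  ∈-smallResidues : ∀ {i} k (k<p : k < p) → 0 < i → i ≤ k → + i ∈ smallResidues k k<p
  ∈-smallResidues zero    _   0<i i≤0 = contradiction i≤0 (ℕ.<⇒≱ 0<i)
  ∈-smallResidues (suc k) k<p 0<i i≤1+k with ℕ.m≤n⇒m<n∨m≡n i≤1+k
  ... | inj₁ i<1+k = there (∈-smallResidues k _ 0<i (ℕ.≤-pred i<1+k))
  ... | inj₂ refl  = here ≈-refl

  smallResidues-nonzero : ∀ k (k<p : k < p) → x ∈ smallResidues k k<p → ¬ (+ p ∣ x)
  smallResidues-nonzero (suc k) k<p (here x≈1+k) p∣x =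
    small-nonzero (suc k) (s≤s z≤n) k<p (∣-resp-≈ x≈1+k p∣x)
  smallResidues-nonzero (suc k) k<p (there x∈) = smallResidues-nonzero k _ x∈

  nonzeroResidues : Residues
  nonzeroResidues = smallResidues (d ℕ.+ d) (subst (d ℕ.+ d <_) (sym p≡1+2d) (ℕ.n<1+n (d ℕ.+ d)))

  length-nonzeroResidues : length nonzeroResidues ≡ d ℕ.+ d
  length-nonzeroResidues = length-smallResidues (d ℕ.+ d) _

  ∈-nonzeroResidues : ¬ (+ p ∣ x) → x ∈ nonzeroResidues
  ∈-nonzeroResidues {x} p∤x with x %ℕ p | ≈-residue x | n%ℕd<d x p
  ... | zero  | x≈0   | _     = contradiction (≈0⇒∣ x≈0) p∤x
  ... | suc r | x≈1+r | 1+r<p = ≈-subst-∈ (≈-sym x≈1+r)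
    (∈-smallResidues _ _ (s≤s z≤n) (ℕ.≤-pred (subst (suc r <_) p≡1+2d 1+r<p)))

  nonzeroResidues-Paired : ¬ (+ p ∣ c) → Paired c nonzeroResidues
  nonzeroResidues-Paired {c} p∤c {x} x∈ with inverse (smallResidues-nonzero _ _ x∈)
  ... | x⁻¹ , xx⁻¹≈1 = x⁻¹ * c , ∈-nonzeroResidues p∤x⁻¹c , xx⁻¹c≈c
    where
    xx⁻¹c≈c : x * (x⁻¹ * c) ≈ c
    xx⁻¹c≈c = begin
      x * (x⁻¹ * c)   ≡⟨ ℤ.*-assoc x x⁻¹ c ⟨
      x * x⁻¹ * c     ≈⟨ *-congʳ c xx⁻¹≈1 ⟩
      1ℤ * c          ≡⟨ ℤ.*-identityˡ c ⟩
      c               ∎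
    p∤x⁻¹c : ¬ (+ p ∣ x⁻¹ * c)
    p∤x⁻¹c = factor-nonzero p∤c x xx⁻¹c≈c

  product-nonzeroResidues-nonsquare : ¬ (+ p ∣ c) → ¬ IsSquare c → product nonzeroResidues ≈ c ^ d
  product-nonzeroResidues-nonsquare p∤c nonsquare =
    product-pairs p∤c d nonzeroResidues length-nonzeroResidues (nonzeroResidues-Paired p∤c)
      (λ {x} _ x²≈c → nonsquare (x , x²≈c))

  product-nonzeroResidues-square : ∀ {c s} → ¬ (+ p ∣ c) → s * s ≈ c → product nonzeroResidues ≈ - (c ^ d)
  product-nonzeroResidues-square {s = s} p∤c s²≈c =
    product-pairs-with-roots p∤c d nonzeroResidues length-nonzeroResidues (nonzeroResidues-Paired p∤c) s²≈c
      (∈-nonzeroResidues (factor-nonzero p∤c s s²≈c))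
      (∈-nonzeroResidues (factor-nonzero p∤c (- s) (-‿square s s²≈c)))

  wilson : product nonzeroResidues ≈ - 1ℤ
  wilson = ≈-trans (product-nonzeroResidues-square {s = 1ℤ} p∤1 ≈-refl)
                   (≡⇒≈ (cong -_ (ℤ.^-zeroˡ d)))

  euler-square : ¬ (+ p ∣ c) → IsSquare c → c ^ d ≈ 1ℤ
  euler-square {c} p∤c (s , s²≈c) = begin
    c ^ d                        ≡⟨ ℤ.neg-involutive (c ^ d) ⟨
    - - (c ^ d)                  ≈⟨ -‿cong (product-nonzeroResidues-square {s = s} p∤c s²≈c) ⟨
    - product nonzeroResidues    ≈⟨ -‿cong wilson ⟩
    - - 1ℤ                       ∎

  euler-nonsquare : ¬ (+ p ∣ c) → ¬ IsSquare c → c ^ d ≈ - 1ℤ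
  euler-nonsquare p∤c nonsquare =
    ≈-trans (≈-sym (product-nonzeroResidues-nonsquare p∤c nonsquare)) wilson

  euler-criterion : ¬ (+ p ∣ c) → (ε ≡ 1ℤ × IsSquare c) ⊎ (ε ≡ - 1ℤ × ¬ IsSquare c) → ε ≈ c ^ d
  euler-criterion p∤c (inj₁ (refl , square))    = ≈-sym (euler-square p∤c square)
  euler-criterion p∤c (inj₂ (refl , nonsquare)) = ≈-sym (euler-nonsquare p∤c nonsquare)

  legendre-euler : Legendre c (+ p) ε → ε ≈ c ^ d
  legendre-euler (p∤c , symbol) = euler-criterion (p∤c ∘ ∣⇒∣ᵤ)
    (Sum.map (Product.map₂ (Product.map₂ (mk≈ ∘ ∣ᵤ⇒∣)))
             (Product.map₂ (_∘ Product.map₂ (∣⇒∣ᵤ ∘ m∣x-y))) symbol)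

-- Reduction of Gaussian integers modulo a prime π = α + βi of norm p

module GaussianPrime (p : ℕ) (p-prime : Prime p) (e : ℕ) (p≡1+4e : p ≡ suc (e ℕ.+ e ℕ.+ (e ℕ.+ e)))
                     (α β : ℤ) (α²+β²≡p : α * α + β * β ≡ + p) where

  open EulerCriterion p p-prime (e ℕ.+ e) p≡1+4e

  π : GI
  π = α , β

  p∤β : ¬ (+ p ∣ β)
  p∤β p∣β = p∤1 (*-cancelˡ-∣ (+ p) (∣-≡ p²∣p (sym (ℤ.*-identityʳ (+ p)))))
    where
    square-∣ : + p ∣ x → + p * + p ∣ x * x
    square-∣ {x} p∣x = ∣-trans (*-monoʳ-∣ (+ p) p∣x) (*-monoˡ-∣ x p∣x)
    cancel-β² : ∀ a b → a * a + b * b - b * b ≡ a * a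
    cancel-β² = solve-∀
    p∣α² : + p ∣ α * α
    p∣α² = ∣-≡ (∣m∣n⇒∣m-n ∣-refl (∣n⇒∣m*n β p∣β))
               (trans (cong (_- β * β) (sym α²+β²≡p)) (cancel-β² α β))
    p∣α : + p ∣ α
    p∣α = Sum.[ id , id ] (euclid {α} {α} p∣α²)
    p²∣p : + p * + p ∣ + p
    p²∣p = ∣-≡ (∣m∣n⇒∣m+n (square-∣ p∣α) (square-∣ p∣β)) α²+β²≡p

  β⁻¹ : ℤ
  β⁻¹ = proj₁ (inverse p∤β)

  ββ⁻¹≈1 : β * β⁻¹ ≈ 1ℤ
  ββ⁻¹≈1 = proj₂ (inverse p∤β)

  j : ℤ
  j = - (α * β⁻¹)

  α+βj≈0 : α + β * j ≈ 0ℤ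
  α+βj≈0 = begin
    α + β * j             ≡⟨ expand α β β⁻¹ ⟩
    α - α * (β * β⁻¹)     ≈⟨ +-congˡ α (-‿cong (*-congˡ α ββ⁻¹≈1)) ⟩
    α - α * 1ℤ            ≡⟨ cancel α ⟩
    0ℤ                    ∎
    where
    open ≈-Reasoning
    expand : ∀ α β b → α + β * - (α * b) ≡ α - α * (β * b)
    expand = solve-∀
    cancel : ∀ α → α - α * 1ℤ ≡ 0ℤ
    cancel = solve-∀

  j²≈-1 : j * j ≈ - 1ℤ
  j²≈-1 = *-cancelˡ (*-nonzero p∤β p∤β) (begin
    β * β * (j * j)                       ≡⟨ expand α β β⁻¹ ⟩
    α * α * ((β * β⁻¹) * (β * β⁻¹))       ≈⟨ *-congˡ (α * α) (*-cong ββ⁻¹≈1 ββ⁻¹≈1) ⟩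
    α * α * (1ℤ * 1ℤ)                     ≡⟨ add-β² α β ⟩
    (α * α + β * β) - β * β               ≡⟨ cong (_- β * β) α²+β²≡p ⟩
    + p - β * β                           ≈⟨ +-cong m≈0 (≈-refl { - (β * β)}) ⟩
    0ℤ - β * β                            ≡⟨ times-neg-one β ⟩
    β * β * - 1ℤ                          ∎)
    where
    open ≈-Reasoning
    expand : ∀ α β b → β * β * (- (α * b) * - (α * b)) ≡ α * α * ((β * b) * (β * b))
    expand = solve-∀
    add-β² : ∀ α β → α * α * (1ℤ * 1ℤ) ≡ (α * α + β * β) - β * β
    add-β² = solve-∀
    times-neg-one : ∀ β → 0ℤ - β * β ≡ β * β * - 1ℤ
    times-neg-one = solve-∀

  1+j²≈0 : 1ℤ + j * j ≈ 0ℤ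
  1+j²≈0 = +-congˡ 1ℤ j²≈-1

  φ : GI → ℤ
  φ (x , y) = x + y * j

  φ-*G : ∀ z w → φ (z *G w) ≈ φ z * φ w
  φ-*G (x₁ , y₁) (x₂ , y₂) = begin
    (x₁ * x₂ - y₁ * y₂) + (x₁ * y₂ + y₁ * x₂) * j           ≡⟨ expand x₁ y₁ x₂ y₂ j ⟩
    (x₁ + y₁ * j) * (x₂ + y₂ * j) - y₁ * y₂ * (1ℤ + j * j)  ≈⟨ +-congˡ ((x₁ + y₁ * j) * (x₂ + y₂ * j))
                                                                  (-‿cong (*-congˡ (y₁ * y₂) 1+j²≈0)) ⟩
    (x₁ + y₁ * j) * (x₂ + y₂ * j) - y₁ * y₂ * 0ℤ            ≡⟨ drop x₁ y₁ x₂ y₂ j ⟩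
    (x₁ + y₁ * j) * (x₂ + y₂ * j)                           ∎
    where
    open ≈-Reasoning
    expand : ∀ a b c d j → (a * c - b * d) + (a * d + b * c) * j ≡ (a + b * j) * (c + d * j) - b * d * (1ℤ + j * j)
    expand = solve-∀
    drop : ∀ a b c d j → (a + b * j) * (c + d * j) - b * d * 0ℤ ≡ (a + b * j) * (c + d * j)
    drop = solve-∀

  φ--G : ∀ z w → φ (z -G w) ≡ φ z - φ w
  φ--G (x₁ , y₁) (x₂ , y₂) = rearrange x₁ y₁ x₂ y₂ j
    where
    rearrange : ∀ a b c d j → (a - c) + (b - d) * j ≡ (a + b * j) - (c + d * j)
    rearrange = solve-∀

  φ-π*G≈0 : ∀ w → φ (π *G w) ≈ 0ℤ
  φ-π*G≈0 w = ≈-trans (φ-*G π w) (≈-trans (*-congʳ (φ w) α+βj≈0) (≡⇒≈ (ℤ.*-zeroˡ (φ w))))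

  -- x + yi = π · (x + yi)π̄ / p, where (x + yi)π̄ = (xα + yβ) + (yα - xβ)i and ππ̄ = p.
  conjugate-divisible⇒π∣G : + p ∣ x * α + y * β → + p ∣ y * α - x * β → π ∣G (x , y)
  conjugate-divisible⇒π∣G {x} {y} (divides u re≡up) (divides v im≡vp) =
    (u , v) , cong₂ _,_ (ℤ.*-cancelʳ-≡ _ _ (+ p) re) (ℤ.*-cancelʳ-≡ _ _ (+ p) im)
    where
    open ≡-Reasoning
    expand-re : ∀ α β u v P → (α * u - β * v) * P ≡ α * (u * P) - β * (v * P)
    expand-re = solve-∀
    collect-re : ∀ x y α β → α * (x * α + y * β) - β * (y * α - x * β) ≡ x * (α * α + β * β)
    collect-re = solve-∀
    expand-im : ∀ α β u v P → (α * v + β * u) * P ≡ α * (v * P) + β * (u * P)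
    expand-im = solve-∀
    collect-im : ∀ x y α β → α * (y * α - x * β) + β * (x * α + y * β) ≡ y * (α * α + β * β)
    collect-im = solve-∀
    re : (α * u - β * v) * + p ≡ x * + p
    re = begin
      (α * u - β * v) * + p                      ≡⟨ expand-re α β u v (+ p) ⟩
      α * (u * + p) - β * (v * + p)              ≡⟨ cong₂ (λ s t → α * s - β * t) re≡up im≡vp ⟨
      α * (x * α + y * β) - β * (y * α - x * β)  ≡⟨ collect-re x y α β ⟩
      x * (α * α + β * β)                        ≡⟨ cong (x *_) α²+β²≡p ⟩
      x * + p                                    ∎
    im : (α * v + β * u) * + p ≡ y * + p
    im = begin
      (α * v + β * u) * + p                      ≡⟨ expand-im α β u v (+ p) ⟩
      α * (v * + p) + β * (u * + p)              ≡⟨ cong₂ (λ s t → α * t + β * s) re≡up im≡vp ⟨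
      α * (y * α - x * β) + β * (x * α + y * β)  ≡⟨ collect-im x y α β ⟩
      y * (α * α + β * β)                        ≡⟨ cong (y *_) α²+β²≡p ⟩
      y * + p                                    ∎

  φ≈0⇒π∣G : ∀ k → φ k ≈ 0ℤ → π ∣G k
  φ≈0⇒π∣G (x , y) φ≈0 = conjugate-divisible⇒π∣G (≈0⇒∣ re≈0) (≈0⇒∣ im≈0)
    where
    open ≈-Reasoning
    re≈ : ∀ x y α β j → x * α + y * β ≡ x * (α + β * j) - β * j * (x + y * j) + y * β * (1ℤ + j * j)
    re≈ = solve-∀
    im≈ : ∀ x y α β j → y * α - x * β ≡ y * (α + β * j) - β * (x + y * j)
    im≈ = solve-∀
    vanish₃ : ∀ a b c → a * 0ℤ - b * 0ℤ + c * 0ℤ ≡ 0ℤ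
    vanish₃ = solve-∀
    vanish₂ : ∀ a b → a * 0ℤ - b * 0ℤ ≡ 0ℤ
    vanish₂ = solve-∀
    re≈0 : x * α + y * β ≈ 0ℤ
    re≈0 = begin
      x * α + y * β                                                 ≡⟨ re≈ x y α β j ⟩
      x * (α + β * j) - β * j * (x + y * j) + y * β * (1ℤ + j * j)  ≈⟨ +-cong (+-cong (*-congˡ x α+βj≈0)
                                                                         (-‿cong (*-congˡ (β * j) φ≈0)))
                                                                         (*-congˡ (y * β) 1+j²≈0) ⟩
      x * 0ℤ - β * j * 0ℤ + y * β * 0ℤ                              ≡⟨ vanish₃ x (β * j) (y * β) ⟩
      0ℤ                                                            ∎
    im≈0 : y * α - x * β ≈ 0ℤ
    im≈0 = begin
      y * α - x * β                            ≡⟨ im≈ x y α β j ⟩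
      y * (α + β * j) - β * (x + y * j)        ≈⟨ +-cong (*-congˡ y α+βj≈0) (-‿cong (*-congˡ β φ≈0)) ⟩
      y * 0ℤ - β * 0ℤ                          ≡⟨ vanish₂ y β ⟩
      0ℤ                                       ∎

  GaussQR⇒IsSquare : ∀ {k} → GaussQR k π → IsSquare (φ k)
  GaussQR⇒IsSquare {k} (x , w , π*w≡x²-k) = φ x , (begin
    φ x * φ x                  ≈⟨ φ-*G x x ⟨
    φ (x *G x)                 ≡⟨ sub-add (φ (x *G x)) (φ k) ⟩
    φ (x *G x) - φ k + φ k     ≡⟨ cong (_+ φ k) (φ--G (x *G x) k) ⟨
    φ (x *G x -G k) + φ k      ≡⟨ cong (λ t → φ t + φ k) π*w≡x²-k ⟨
    φ (π *G w) + φ k           ≈⟨ +-cong (φ-π*G≈0 w) (≈-refl {φ k}) ⟩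
    0ℤ + φ k                   ≡⟨ ℤ.+-identityˡ (φ k) ⟩
    φ k                        ∎)
    where
    open ≈-Reasoning
    sub-add : ∀ a b → a ≡ a - b + b
    sub-add = solve-∀

  IsSquare⇒GaussQR : ∀ {k} → IsSquare (φ k) → GaussQR k π
  IsSquare⇒GaussQR {k} (t , t²≈φk) = (t , 0ℤ) , φ≈0⇒π∣G ((t , 0ℤ) *G (t , 0ℤ) -G k) (begin
    φ ((t , 0ℤ) *G (t , 0ℤ) -G k)   ≡⟨ φ--G ((t , 0ℤ) *G (t , 0ℤ)) k ⟩
    φ ((t , 0ℤ) *G (t , 0ℤ)) - φ k  ≡⟨ cong (_- φ k) (real-square t j) ⟩
    t * t - φ k                     ≈⟨ +-cong t²≈φk (≈-refl { - φ k}) ⟩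
    φ k - φ k                       ≡⟨ ℤ.+-inverseʳ (φ k) ⟩
    0ℤ                              ∎)
    where
    open ≈-Reasoning
    real-square : ∀ t j → (t * t - 0ℤ * 0ℤ) + (t * 0ℤ + 0ℤ * t) * j ≡ t * t
    real-square = solve-∀

  gaussLegendre≈φ^d : ∀ {k} → GaussLegendre k π ε → ε ≈ φ k ^ (e ℕ.+ e)
  gaussLegendre≈φ^d (π∤k , symbol) = euler-criterion (λ p∣φk → π∤k (φ≈0⇒π∣G _ (∣⇒≈0 p∣φk)))
    (Sum.map (Product.map₂ GaussQR⇒IsSquare) (Product.map₂ (_∘ IsSquare⇒GaussQR)) symbol)

  φ[a+bi]φ[b+ai]≈qj : ∀ a b {q} → a * a + b * b ≡ + q → φ (a , b) * φ (b , a) ≈ + q * j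
  φ[a+bi]φ[b+ai]≈qj a b {q} a²+b²≡q = begin
    (a + b * j) * (b + a * j)                   ≡⟨ expand a b j ⟩
    (a * a + b * b) * j + a * b * (1ℤ + j * j)   ≈⟨ +-cong (≡⇒≈ (cong (_* j) a²+b²≡q)) (*-congˡ (a * b) 1+j²≈0) ⟩
    + q * j + a * b * 0ℤ                         ≡⟨ drop (+ q * j) (a * b) ⟩
    + q * j                                      ∎
    where
    open ≈-Reasoning
    expand : ∀ a b j → (a + b * j) * (b + a * j) ≡ (a * a + b * b) * j + a * b * (1ℤ + j * j)
    expand = solve-∀
    drop : ∀ x y → x + y * 0ℤ ≡ x
    drop = solve-∀

  j^2e≈[-1]^e : j ^ (e ℕ.+ e) ≈ (- 1ℤ) ^ e
  j^2e≈[-1]^e = ≈-trans (≡⇒≈ (trans (ℤ.^-distribˡ-+-* j e e) (sym (^-distribʳ-* e)))) (^-cong e j²≈-1)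

  symbol-product : ∀ {a b q ε₁ ε₂ λ₀} → a * a + b * b ≡ + q →
                   GaussLegendre (a , b) π ε₁ → GaussLegendre (b , a) π ε₂ → Legendre (+ q) (+ p) λ₀ →
                   ε₁ * ε₂ ≡ (- 1ℤ) ^ e * λ₀
  symbol-product {a} {b} {q} {ε₁} {ε₂} {λ₀} a²+b²≡q [a+bi/π] [b+ai/π] [q/p] =
    IsSign-≈⇒≡ (IsSign-* (symbol-IsSign (proj₂ [a+bi/π])) (symbol-IsSign (proj₂ [b+ai/π])))
               (IsSign-* (IsSign-^ e (inj₂ refl)) (symbol-IsSign (proj₂ [q/p]))) (begin
      ε₁ * ε₂                               ≈⟨ *-cong (gaussLegendre≈φ^d [a+bi/π]) (gaussLegendre≈φ^d [b+ai/π]) ⟩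
      φ (a , b) ^ d * φ (b , a) ^ d         ≡⟨ ^-distribʳ-* d ⟨
      (φ (a , b) * φ (b , a)) ^ d           ≈⟨ ^-cong d (φ[a+bi]φ[b+ai]≈qj a b a²+b²≡q) ⟩
      (+ q * j) ^ d                         ≡⟨ ^-distribʳ-* d ⟩
      (+ q) ^ d * j ^ d                     ≈⟨ *-cong (≈-sym (legendre-euler [q/p])) j^2e≈[-1]^e ⟩
      λ₀ * (- 1ℤ) ^ e                       ≡⟨ ℤ.*-comm λ₀ _ ⟩
      (- 1ℤ) ^ e * λ₀                       ∎)
    where
    open ≈-Reasoning
    d : ℕ
    d = e ℕ.+ e

mainTheorem1 : (α β a b : ℤ) (p q : ℕ) →
    normG (α , β) ≡ p → Prime p → p % 4 ≡ 1 →
    normG (a , b) ≡ q → Prime q → q % 4 ≡ 1 →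
    ¬ (q ≡ p) →
    (ε₁ ε₂ λ₀ : ℤ) →
    GaussLegendre (a , b) (α , β) ε₁ →
    GaussLegendre (b , a) (α , β) ε₂ →
    Legendre (+ q) (+ p) λ₀ →
    (ε₁ * ε₂ ≡ ((- + 1) ^ ((p ∸ 1) / 4)) * λ₀)
      × ((ε₁ ≡ ε₂) ⇔ (((- + 1) ^ ((p ∸ 1) / 4)) * λ₀ ≡ + 1))
mainTheorem1 α β a b p q N[π]≡p p-prime p%4≡1 N[a+bi]≡q _ _ _ ε₁ ε₂ λ₀ [a+bi/π] [b+ai/π] [q/p] =
  product≡ , mk⇔ (λ { refl → trans (sym product≡) (IsSign-square sign₁) })
                 (λ ≡1 → IsSign-*≡1⇒≡ sign₁ sign₂ (trans product≡ ≡1))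
  where
  open GaussianPrime p p-prime ((p ∸ 1) / 4) (p%4≡1⇒p≡1+4[p-1]/4 p%4≡1) α β (normG≡⇒sum-of-squares≡ α β N[π]≡p)
  product≡ : ε₁ * ε₂ ≡ (- 1ℤ) ^ ((p ∸ 1) / 4) * λ₀
  product≡ = symbol-product (normG≡⇒sum-of-squares≡ a b N[a+bi]≡q) [a+bi/π] [b+ai/π] [q/p]
  sign₁ : IsSign ε₁
  sign₁ = symbol-IsSign (proj₂ [a+bi/π])
  sign₂ : IsSign ε₂
  sign₂ = symbol-IsSign (proj₂ [b+ai/π])
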